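{- Let $r\geqslant 3$ be an odd integer and let $\Gamma\cong\mathbb{Z}_{4r}\oplus\mathbb{Z}_4$. Then there exists a zero-sum $\Gamma$-magic rectangle set $\mathrm{MRS}_\Gamma(r,8;2)$, i.e. two $r\times 8$ arrays with entries in $\Gamma$ such that every element of $\Gamma$ appears exactly once and in exactly one of the two arrays, and every row sum and every column sum of each array equals $0_\Gamma$. -}

module Defs where

open import Data.Nat using (ℕ; suc; NonZero; _*_)
open import Data.Nat.DivMod using (_mod_)
open import Data.Fin using (Fin; toℕ; zero)
import Data.Fin
open import Data.Product using (_×_; _,_; Σ)
open import Relation.Binary.PropositionalEquality using (_≡_)
import Data.Nat as N

_+ₘ_ : ∀ {n} .{{_ : NonZero n}} → Fin n → Fin n → Fin n
_+ₘ_ {n} a b = (toℕ a N.+ toℕ b) mod n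

Γ : ℕ → Set
Γ r = Fin (4 * r) × Fin 4

module _ (r : ℕ) .{{_ : NonZero (4 * r)}} where

  _⊕_ : Γ r → Γ r → Γ r
  (a , b) ⊕ (c , d) = (a +ₘ c) , (b +ₘ d)

  0Γ : Γ r
  0Γ = (0 mod (4 * r)) , zero

  ΣΓ : ∀ {m} → (Fin m → Γ r) → Γ r
  ΣΓ {ℕ.zero} f = 0Γ
  ΣΓ {suc m} f = f zero ⊕ ΣΓ (λ i → f (Data.Fin.suc i))

  record ZeroSumMRS (a b c : ℕ) : Set where
    field
      entry : Fin c → Fin a → Fin b → Γ r
      injective : ∀ k i j k' i' j' → entry k i j ≡ entry k' i' j' →
                  (k ≡ k') × (i ≡ i') × (j ≡ j')
      surjective : ∀ g → Σ (Fin c) λ k → Σ (Fin a) λ i → Σ (Fin b) λ j → entry k i j ≡ g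
      rowSum : ∀ k i → ΣΓ (λ j → entry k i j) ≡ 0Γ
      colSum : ∀ k j → ΣΓ (λ i → entry k i j) ≡ 0Γ

{-# OPTIONS --safe #-}
module Submission where

-- Write the first coordinate of an element of Z_{4r} ⊕ Z_4 as q r + x with q < 4 and x < r, and
-- read x as one of the residues 0, ±1, …, ±(k + 1) modulo r = 2k + 3.  The first three rows of
-- both arrays follow a fixed pattern on the residues 0, ±1, and every further pair of rows follows
-- a fixed pattern on the residues ±y for one y ∈ {2, …, k + 1}.
-- If a line of such a pattern has p entries with residue +y and m entries with residue −y, its
-- first coordinates add up to Q r + p y + m (r − y), that is (Q + m) r when p = m.  So the line
-- sums to zero once p = m, 4 ∣ Q + m and 4 divides the sum of its Z_4-coordinates: conditions
-- independent of r, which (like the bijectivity of the patterns) are checked by evaluation.  A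
-- column is one column of the three-row pattern together with one column of each pair pattern.

open import Defs
open import Algebra.Properties.CommutativeSemigroup using (x∙yz≈y∙xz)
open import Data.Fin
  using (Fin; zero; suc; toℕ; _↑ˡ_; _↑ʳ_; combine; remQuot; splitAt; cast; opposite)
open import Data.Fin.Patterns using (0F; 1F; 2F; 3F)
open import Data.Fin.Properties
  using (toℕ-fromℕ<; toℕ-injective; toℕ<n; toℕ-↑ˡ; toℕ-↑ʳ; toℕ-cast; toℕ-combine; cast-involutive;
         +↔⊎; *↔×; remQuot-combine; combine-remQuot; splitAt-↑ˡ; splitAt-↑ʳ; splitAt⁻¹-↑ˡ;
         splitAt⁻¹-↑ʳ; opposite-prop; opposite-involutive; all?; any?)
  renaming (_≟_ to _≟ᶠ_)
open import Data.Nat using (ℕ; zero; suc; _+_; _*_; _∸_; _%_; NonZero)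
open import Data.Nat.DivMod using (_mod_; _/_; m≡m%n+[m/n]*n; [m+kn]%n≡m%n; %-remove-+ʳ)
open import Data.Nat.Divisibility using (_∣_; _∣?_; _∣0; ∣m∣n⇒∣m+n; *-monoˡ-∣)
open import Data.Nat.Properties
  using (+-*-semiring; +-commutativeSemigroup; +-assoc; +-suc; +-identityʳ; *-comm;
         *-distribˡ-+; *-distribʳ-+; m+[n∸m]≡n)
  renaming (_≟_ to _≟ℕ_)
open import Algebra.Properties.Semiring.Sum +-*-semiring
  using (sum; sum-syntax; sum-cong-≗; ∑-distrib-+; ∑-comm; *-distribʳ-sum)
open import Data.Product using (_×_; _,_; proj₁; proj₂; ∃)
open import Data.Product.Function.NonDependent.Propositional using (_×-↔_)
open import Data.Product.Properties using (≡-dec)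
open import Data.Sum using (_⊎_; inj₁; inj₂; [_,_]′)
open import Data.Sum.Function.Propositional using (_⊎-↔_)
open import Data.Vec using (Vec; _∷_; []; lookup)
open import Function
  using (_∘_; _↔_; Inverse; Injection; Injective; StrictlySurjective; mk↔ₛ′; mk⤖)
open import Function.Consequences.Propositional using (strictlySurjective⇒surjective)
open import Function.Construct.Composition using (_↔-∘_)
open import Function.Construct.Identity using (↔-id)
open import Function.Properties.Bijection using (⤖⇒↔)
open import Function.Properties.Inverse using (↔-sym; ↔⇒↣)
open import Relation.Binary.Definitions using (DecidableEquality)
open import Relation.Binary.PropositionalEquality
open import Relation.Nullary.Decidable using (Dec; True; toWitness; map′; _×-dec_; _→-dec_)
open import Relation.Unary using (Decidable)

∑-↑ : ∀ m {n} (f : Fin (m + n) → ℕ) → sum f ≡ sum (f ∘ (_↑ˡ n)) + sum (f ∘ (m ↑ʳ_))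
∑-↑ zero    f = refl
∑-↑ (suc m) f = trans (cong (f zero +_) (∑-↑ m (f ∘ suc))) (sym (+-assoc (f zero) _ _))

∑-combine : ∀ m {n} (f : Fin (m * n) → ℕ) → sum f ≡ ∑[ i < m ] ∑[ j < n ] f (combine i j)
∑-combine zero        f = refl
∑-combine (suc m) {n} f =
  trans (∑-↑ n f) (cong (sum (f ∘ (_↑ˡ m * n)) +_) (∑-combine m (f ∘ (n ↑ʳ_))))

∣-sum : ∀ {d n} (f : Fin n → ℕ) → (∀ i → d ∣ f i) → d ∣ sum f
∣-sum {d} {zero}  f _   = d ∣0
∣-sum {d} {suc n} f d∣f = ∣m∣n⇒∣m+n (d∣f zero) (∣-sum (f ∘ suc) (d∣f ∘ suc))

module _ {d} .{{_ : NonZero d}} where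

  %≡⇒mod≡ : ∀ {m n} → m % d ≡ n % d → m mod d ≡ n mod d
  %≡⇒mod≡ eq = toℕ-injective (trans (toℕ-fromℕ< _) (trans eq (sym (toℕ-fromℕ< _))))

  ∣⇒mod≡0 : ∀ {m} → d ∣ m → m mod d ≡ 0 mod d
  ∣⇒mod≡0 d∣m = %≡⇒mod≡ (%-remove-+ʳ 0 d∣m)

  [m+n%d]%d≡[m+n]%d : ∀ m n → (m + n % d) % d ≡ (m + n) % d
  [m+n%d]%d≡[m+n]%d m n = begin
    (m + n % d) % d                ≡⟨ [m+kn]%n≡m%n (m + n % d) (n / d) d ⟨
    (m + n % d + n / d * d) % d    ≡⟨ cong (_% d) (+-assoc m (n % d) _) ⟩
    (m + (n % d + n / d * d)) % d  ≡⟨ cong (λ t → (m + t) % d) (m≡m%n+[m/n]*n n d) ⟨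
    (m + n) % d                    ∎
    where open ≡-Reasoning

  +ₘ-mod : ∀ (a : Fin d) n → a +ₘ (n mod d) ≡ (toℕ a + n) mod d
  +ₘ-mod a n =
    %≡⇒mod≡ (trans (cong (λ t → (toℕ a + t) % d) (toℕ-fromℕ< _)) ([m+n%d]%d≡[m+n]%d (toℕ a) n))

record ZeroSum r {n} (g : Fin n → Γ r) : Set where
  constructor zeroSum
  field
    ∣∑proj₁ : 4 * r ∣ sum (toℕ ∘ proj₁ ∘ g)
    ∣∑proj₂ : 4 ∣ sum (toℕ ∘ proj₂ ∘ g)

module _ {r} .{{_ : NonZero (4 * r)}} where

  ΣΓ-mod : ∀ {n} (g : Fin n → Γ r) →
           ΣΓ r g ≡ (sum (toℕ ∘ proj₁ ∘ g) mod (4 * r) , sum (toℕ ∘ proj₂ ∘ g) mod 4)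
  ΣΓ-mod {zero}  g = refl
  ΣΓ-mod {suc n} g = trans (cong (_⊕_ r (g zero)) (ΣΓ-mod (g ∘ suc)))
                           (cong₂ _,_ (+ₘ-mod (proj₁ (g zero)) _) (+ₘ-mod (proj₂ (g zero)) _))

  ZeroSum⇒ΣΓ≡0Γ : ∀ {n} {g : Fin n → Γ r} → ZeroSum r g → ΣΓ r g ≡ 0Γ r
  ZeroSum⇒ΣΓ≡0Γ {g = g} (zeroSum ∣₁ ∣₂) = trans (ΣΓ-mod g) (cong₂ _,_ (∣⇒mod≡0 ∣₁) (∣⇒mod≡0 ∣₂))

data Sign : Set where
  null plus minus : Sign

isPlus isMinus : Sign → ℕ
isPlus plus   = 1
isPlus _      = 0
isMinus minus = 1
isMinus _     = 0

weight : ℕ → ℕ → Sign → ℕ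
weight u v null  = 0
weight u v plus  = u
weight u v minus = v

weight≡ : ∀ u v s → weight u v s ≡ isPlus s * u + isMinus s * v
weight≡ u v null  = refl
weight≡ u v plus  = sym (trans (+-identityʳ (u + 0)) (+-identityʳ u))
weight≡ u v minus = sym (+-identityʳ v)

∑-weight : ∀ {n} u v (s : Fin n → Sign) →
           sum (weight u v ∘ s) ≡ sum (isPlus ∘ s) * u + sum (isMinus ∘ s) * v
∑-weight {n} u v s = begin
  sum (weight u v ∘ s)                                          ≡⟨ sum-cong-≗ (weight≡ u v ∘ s) ⟩
  sum (λ j → isPlus (s j) * u + isMinus (s j) * v)              ≡⟨ ∑-distrib-+ {n} _ _ ⟩
  sum (λ j → isPlus (s j) * u) + sum (λ j → isMinus (s j) * v)
    ≡⟨ cong₂ _+_ (*-distribʳ-sum u (isPlus ∘ s)) (*-distribʳ-sum v (isMinus ∘ s)) ⟨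
  sum (isPlus ∘ s) * u + sum (isMinus ∘ s) * v                  ∎
  where open ≡-Reasoning

-- (q , l , b) stands for the element (q r + x , b) of Z_{4r} ⊕ Z_4, where x is the residue
-- modulo r carrying the label l.
Cell : Set → Set
Cell L = Fin 4 × L × Fin 4

relabel : ∀ {A B L L′ : Set} → (L → L′) → A × L × B → A × L′ × B
relabel f (a , l , b) = a , f l , b

module _ {n} (f : Fin n → Cell Sign) where

  quarters pluses minuses coords : ℕ
  quarters = sum (toℕ ∘ proj₁ ∘ f)
  pluses   = sum (isPlus ∘ proj₁ ∘ proj₂ ∘ f)
  minuses  = sum (isMinus ∘ proj₁ ∘ proj₂ ∘ f)
  coords   = sum (toℕ ∘ proj₂ ∘ proj₂ ∘ f)

  Balanced : Set
  Balanced = pluses ≡ minuses × 4 ∣ quarters + minuses × 4 ∣ coords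

  balanced? : Dec Balanced
  balanced? = pluses ≟ℕ minuses ×-dec 4 ∣? quarters + minuses ×-dec 4 ∣? coords

value : ℕ → ℕ → ℕ → Cell Sign → ℕ
value r u v (q , s , _) = toℕ q * r + weight u v s

balanced⇒∣ : ∀ {r u v n} (f : Fin n → Cell Sign) → Balanced f → u + v ≡ r →
             4 * r ∣ sum (value r u v ∘ f)
balanced⇒∣ {r} {u} {v} {n} f (p≡m , 4∣Q+M , _) u+v≡r =
  subst (4 * r ∣_) (sym ∑value≡) (*-monoˡ-∣ r 4∣Q+M)
  where
  Q = quarters f
  M = minuses f

  ∑value≡ : sum (value r u v ∘ f) ≡ (Q + M) * r
  ∑value≡ = begin
    sum (value r u v ∘ f)                                ≡⟨ ∑-distrib-+ {n} _ _ ⟩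
    sum (λ j → toℕ (proj₁ (f j)) * r) + sum (weight u v ∘ proj₁ ∘ proj₂ ∘ f)
      ≡⟨ cong₂ _+_ (sym (*-distribʳ-sum r (toℕ ∘ proj₁ ∘ f))) (∑-weight u v (proj₁ ∘ proj₂ ∘ f)) ⟩
    Q * r + (pluses f * u + M * v)                       ≡⟨ cong (λ p → Q * r + (p * u + M * v)) p≡m ⟩
    Q * r + (M * u + M * v)                              ≡⟨ cong (Q * r +_) (*-distribˡ-+ M u v) ⟨
    Q * r + M * (u + v)                                  ≡⟨ cong (λ t → Q * r + M * t) u+v≡r ⟩
    Q * r + M * r                                        ≡⟨ *-distribʳ-+ r Q M ⟨
    (Q + M) * r                                          ∎
    where open ≡-Reasoning

module _ {l m n : ℕ} where

  ∀³? : ∀ {P : Fin l × Fin m × Fin n → Set} → Decidable P → Dec (∀ x → P x)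
  ∀³? P? = map′ (λ h (a , b , c) → h a b c) (λ h a b c → h (a , b , c))
                (all? λ a → all? λ b → all? λ c → P? (a , b , c))

  ∃³? : ∀ {P : Fin l × Fin m × Fin n → Set} → Decidable P → Dec (∃ P)
  ∃³? P? = map′ (λ (a , b , c , p) → (a , b , c) , p) (λ ((a , b , c) , p) → a , b , c , p)
                (any? λ a → any? λ b → any? λ c → P? (a , b , c))

  _≟³_ : DecidableEquality (Fin l × Fin m × Fin n)
  _≟³_ = ≡-dec _≟ᶠ_ (≡-dec _≟ᶠ_ _≟ᶠ_)

record Block (c w ℓ : ℕ) (sign : Fin ℓ → Sign) : Set where
  field
    table         : Fin c × Fin ℓ × Fin w → Cell (Fin ℓ)
    injective     : Injective _≡_ _≡_ table
    surjective    : StrictlySurjective _≡_ table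
    rows-balanced : ∀ a ρ → Balanced (λ j → relabel sign (table (a , ρ , j)))
    cols-balanced : ∀ a j → Balanced (λ ρ → relabel sign (table (a , ρ , j)))

  table↔ : (Fin c × Fin ℓ × Fin w) ↔ Cell (Fin ℓ)
  table↔ = ⤖⇒↔ (mk⤖ (injective , strictlySurjective⇒surjective surjective))

block : ∀ {c w ℓ} (sign : Fin ℓ → Sign) (t : Fin c × Fin ℓ × Fin w → Cell (Fin ℓ)) →
        {True (∀³? λ x → ∀³? λ y → t x ≟³ t y →-dec x ≟³ y)} →
        {True (∀³? λ y → ∃³? λ x → t x ≟³ y)} →
        {True (all? λ a → all? λ ρ → balanced? (λ j → relabel sign (t (a , ρ , j))))} →
        {True (all? λ a → all? λ j → balanced? (λ ρ → relabel sign (t (a , ρ , j))))} →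
        Block c w ℓ sign
block sign t {inj} {surj} {rows} {cols} = record
  { table         = t
  ; injective     = λ {x} {y} → toWitness inj x y
  ; surjective    = toWitness surj
  ; rows-balanced = toWitness rows
  ; cols-balanced = toWitness cols
  }

topSign : Fin 3 → Sign
topSign 0F = null
topSign 1F = plus
topSign 2F = minus

pairSign : Fin 2 → Sign
pairSign 0F = plus
pairSign 1F = minus

-- Read with r = 3 (residues 0, 1, 2 for the labels 0F, 1F, 2F) these are the two arrays of an
-- MRS(3, 8; 2) over Z_12 ⊕ Z_4.
topTable : Fin 2 × Fin 3 × Fin 8 → Cell (Fin 3)
topTable (a , ρ , j) = lookup (lookup (lookup arrays a) ρ) j
  where
  arrays : Vec (Vec (Vec (Cell (Fin 3)) 8) 3) 2
  arrays =
    ( ((1F , 0F , 1F) ∷ (1F , 1F , 0F) ∷ (2F , 2F , 3F) ∷ (3F , 0F , 2F) ∷ (2F , 1F , 1F) ∷ (3F , 2F , 3F) ∷ (3F , 1F , 0F) ∷ (2F , 2F , 2F) ∷ [])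
      ∷ ((1F , 1F , 1F) ∷ (1F , 2F , 0F) ∷ (0F , 0F , 3F) ∷ (1F , 2F , 1F) ∷ (0F , 0F , 0F) ∷ (2F , 1F , 0F) ∷ (2F , 2F , 1F) ∷ (2F , 1F , 2F) ∷ [])
      ∷ ((1F , 2F , 2F) ∷ (1F , 0F , 0F) ∷ (1F , 1F , 2F) ∷ (3F , 1F , 1F) ∷ (1F , 2F , 3F) ∷ (2F , 0F , 1F) ∷ (2F , 0F , 3F) ∷ (3F , 0F , 0F) ∷ [])
      ∷ [])
    ∷ ( ((0F , 0F , 1F) ∷ (1F , 1F , 3F) ∷ (0F , 2F , 2F) ∷ (3F , 0F , 3F) ∷ (0F , 1F , 2F) ∷ (3F , 2F , 2F) ∷ (2F , 1F , 3F) ∷ (0F , 2F , 0F) ∷ [])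
      ∷ ((0F , 1F , 3F) ∷ (0F , 2F , 3F) ∷ (3F , 0F , 1F) ∷ (0F , 2F , 1F) ∷ (1F , 0F , 2F) ∷ (3F , 1F , 3F) ∷ (3F , 2F , 1F) ∷ (3F , 1F , 2F) ∷ [])
      ∷ ((3F , 2F , 0F) ∷ (2F , 0F , 2F) ∷ (0F , 1F , 1F) ∷ (0F , 1F , 0F) ∷ (2F , 2F , 0F) ∷ (1F , 0F , 3F) ∷ (2F , 0F , 0F) ∷ (0F , 0F , 2F) ∷ [])
      ∷ [])
    ∷ []

-- In each array the second row is the negative of the first.
pairTable : Fin 2 × Fin 2 × Fin 8 → Cell (Fin 2)
pairTable (a , σ , j) = lookup (lookup (lookup arrays a) σ) j
  where
  arrays : Vec (Vec (Vec (Cell (Fin 2)) 8) 2) 2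
  arrays =
    ( ((0F , 0F , 0F) ∷ (0F , 0F , 2F) ∷ (0F , 1F , 0F) ∷ (0F , 1F , 2F) ∷ (1F , 0F , 0F) ∷ (1F , 0F , 2F) ∷ (1F , 1F , 0F) ∷ (1F , 1F , 2F) ∷ [])
      ∷ ((3F , 1F , 0F) ∷ (3F , 1F , 2F) ∷ (3F , 0F , 0F) ∷ (3F , 0F , 2F) ∷ (2F , 1F , 0F) ∷ (2F , 1F , 2F) ∷ (2F , 0F , 0F) ∷ (2F , 0F , 2F) ∷ [])
      ∷ [])
    ∷ ( ((0F , 0F , 1F) ∷ (0F , 0F , 3F) ∷ (0F , 1F , 1F) ∷ (0F , 1F , 3F) ∷ (1F , 0F , 1F) ∷ (1F , 0F , 3F) ∷ (1F , 1F , 1F) ∷ (1F , 1F , 3F) ∷ [])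
      ∷ ((3F , 1F , 3F) ∷ (3F , 1F , 1F) ∷ (3F , 0F , 3F) ∷ (3F , 0F , 1F) ∷ (2F , 1F , 3F) ∷ (2F , 1F , 1F) ∷ (2F , 0F , 3F) ∷ (2F , 0F , 1F) ∷ [])
      ∷ [])
    ∷ []

topBlock : Block 2 8 3 topSign
topBlock = block topSign topTable

pairBlock : Block 2 8 2 pairSign
pairBlock = block pairSign pairTable

Label : ℕ → Set
Label k = Fin 3 ⊎ (Fin 2 × Fin k)

module _ (k : ℕ) where

  rowLabel↔ : Fin (3 + 2 * k) ↔ Label k
  rowLabel↔ = (↔-id _ ⊎-↔ *↔×) ↔-∘ +↔⊎

  rowLabel : Fin (3 + 2 * k) → Label k
  rowLabel = Inverse.to rowLabel↔

  ∑-rows : (h : Label k → ℕ) →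
           sum (h ∘ rowLabel) ≡ sum (h ∘ inj₁) + ∑[ m < k ] ∑[ σ < 2 ] h (inj₂ (σ , m))
  ∑-rows h = begin
    sum (h ∘ rowLabel)                                             ≡⟨ ∑-↑ 3 (h ∘ rowLabel) ⟩
    sum (h ∘ inj₁) + sum (h ∘ inj₂ ∘ remQuot k)
      ≡⟨ cong (sum (h ∘ inj₁) +_) (∑-combine 2 {k} (h ∘ inj₂ ∘ remQuot k)) ⟩
    sum (h ∘ inj₁) + ∑[ σ < 2 ] ∑[ m < k ] h (inj₂ (remQuot k (combine σ m)))
      ≡⟨ cong (sum (h ∘ inj₁) +_)
              (sum-cong-≗ λ σ → sum-cong-≗ λ m → cong (h ∘ inj₂) (remQuot-combine σ m)) ⟩
    sum (h ∘ inj₁) + ∑[ σ < 2 ] ∑[ m < k ] h (inj₂ (σ , m))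
      ≡⟨ cong (sum (h ∘ inj₁) +_) (∑-comm {2} {k} λ σ m → h (inj₂ (σ , m))) ⟩
    sum (h ∘ inj₁) + ∑[ m < k ] ∑[ σ < 2 ] h (inj₂ (σ , m))        ∎
    where open ≡-Reasoning

  ∣-∑-rows : ∀ {d} (h : Label k → ℕ) → d ∣ sum (h ∘ inj₁) →
             (∀ m → d ∣ ∑[ σ < 2 ] h (inj₂ (σ , m))) → d ∣ sum (h ∘ rowLabel)
  ∣-∑-rows {d} h d∣top d∣pairs = subst (d ∣_) (sym (∑-rows h)) (∣m∣n⇒∣m+n d∣top (∣-sum _ d∣pairs))

module _ (n : ℕ) where

  half : Fin 2 × Fin n → Fin (n + n)
  half (0F , i) = i ↑ˡ n
  half (1F , i) = n ↑ʳ opposite i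

  unhalf : Fin (n + n) → Fin 2 × Fin n
  unhalf j = [ (0F ,_) , (1F ,_) ∘ opposite ]′ (splitAt n j)

  half↔ : (Fin 2 × Fin n) ↔ Fin (n + n)
  half↔ = mk↔ₛ′ half unhalf half-unhalf unhalf-half
    where
    half-unhalf : ∀ j → half (unhalf j) ≡ j
    half-unhalf j with splitAt n j in eq
    ... | inj₁ i = splitAt⁻¹-↑ˡ eq
    ... | inj₂ i = trans (cong (n ↑ʳ_) (opposite-involutive i)) (splitAt⁻¹-↑ʳ eq)

    unhalf-half : ∀ p → unhalf (half p) ≡ p
    unhalf-half (0F , i) = cong [ (0F ,_) , (1F ,_) ∘ opposite ]′ (splitAt-↑ˡ n i n)
    unhalf-half (1F , i) =
      trans (cong [ (0F ,_) , (1F ,_) ∘ opposite ]′ (splitAt-↑ʳ n n (opposite i)))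
            (cong (1F ,_) (opposite-involutive i))

  half-sum : ∀ i → toℕ (half (0F , i)) + suc (toℕ (half (1F , i))) ≡ n + n
  half-sum i = begin
    toℕ (i ↑ˡ n) + suc (toℕ (n ↑ʳ opposite i))
      ≡⟨ cong₂ (λ a b → a + suc b) (toℕ-↑ˡ i n) (toℕ-↑ʳ n (opposite i)) ⟩
    toℕ i + suc (n + toℕ (opposite i))       ≡⟨ cong (λ t → toℕ i + suc (n + t)) (opposite-prop i) ⟩
    toℕ i + suc (n + (n ∸ suc (toℕ i)))      ≡⟨ +-suc (toℕ i) _ ⟩
    suc (toℕ i + (n + (n ∸ suc (toℕ i))))    ≡⟨ cong suc (x∙yz≈y∙xz +-commutativeSemigroup (toℕ i) n _) ⟩
    suc (n + (toℕ i + (n ∸ suc (toℕ i))))    ≡⟨ +-suc n _ ⟨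
    n + (suc (toℕ i) + (n ∸ suc (toℕ i)))    ≡⟨ cong (n +_) (m+[n∸m]≡n (toℕ<n i)) ⟩
    n + n                                    ∎
    where open ≡-Reasoning

Signed : ℕ → Set
Signed n = Fin 1 ⊎ (Fin 2 × Fin n)

cast↔ : ∀ {m n} → m ≡ n → Fin m ↔ Fin n
cast↔ eq = mk↔ₛ′ (cast eq) (cast (sym eq)) (cast-involutive eq (sym eq)) (cast-involutive (sym eq) eq)

module _ (k : ℕ) where

  private
    r≡ : suc (suc k + suc k) ≡ 3 + 2 * k
    r≡ = cong (2 +_) (trans (+-suc k k) (cong (λ t → suc (k + t)) (sym (+-identityʳ k))))

  -- inj₁ 0F is the residue 0, inj₂ (0F , i) is i + 1 and inj₂ (1F , i) is r − (i + 1).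
  residue↔ : Signed (suc k) ↔ Fin (3 + 2 * k)
  residue↔ = cast↔ r≡ ↔-∘ (↔-sym +↔⊎ ↔-∘ (↔-id _ ⊎-↔ half↔ (suc k)))

  residue-zero : toℕ (Inverse.to residue↔ (inj₁ 0F)) ≡ 0
  residue-zero = toℕ-cast r≡ zero

  residue-sum : ∀ i → toℕ (Inverse.to residue↔ (inj₂ (0F , i))) + toℕ (Inverse.to residue↔ (inj₂ (1F , i)))
                      ≡ 3 + 2 * k
  residue-sum i = begin
    toℕ (Inverse.to residue↔ (inj₂ (0F , i))) + toℕ (Inverse.to residue↔ (inj₂ (1F , i)))
      ≡⟨ cong₂ _+_ (toℕ-cast r≡ (suc (half (suc k) (0F , i)))) (toℕ-cast r≡ (suc (half (suc k) (1F , i)))) ⟩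
    suc (toℕ (half (suc k) (0F , i)) + suc (toℕ (half (suc k) (1F , i))))
      ≡⟨ cong suc (half-sum (suc k) i) ⟩
    suc (suc k + suc k)
      ≡⟨ r≡ ⟩
    3 + 2 * k
      ∎
    where open ≡-Reasoning

  -- The three-row pattern gets the residues 0, ±1 and the m-th pair pattern the residues ±(m + 2).
  regroup : Label k ↔ Signed (suc k)
  regroup = mk↔ₛ′ to from to∘from from∘to
    where
    to : Label k → Signed (suc k)
    to (inj₁ 0F)      = inj₁ 0F
    to (inj₁ (suc σ)) = inj₂ (σ , zero)
    to (inj₂ (σ , m)) = inj₂ (σ , suc m)

    from : Signed (suc k) → Label k
    from (inj₁ 0F)          = inj₁ 0F
    from (inj₂ (σ , zero))  = inj₁ (suc σ)
    from (inj₂ (σ , suc m)) = inj₂ (σ , m)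

    to∘from : ∀ s → to (from s) ≡ s
    to∘from (inj₁ 0F)          = refl
    to∘from (inj₂ (σ , zero))  = refl
    to∘from (inj₂ (σ , suc m)) = refl

    from∘to : ∀ l → from (to l) ≡ l
    from∘to (inj₁ 0F)      = refl
    from∘to (inj₁ (suc σ)) = refl
    from∘to (inj₂ (σ , m)) = refl

  residueLabel↔ : Label k ↔ Fin (3 + 2 * k)
  residueLabel↔ = residue↔ ↔-∘ regroup

module _ {A B C D : Set} where

  ⊎-middle↔ : ∀ {L M : Set} → (A × L × B) ↔ (C × L × D) → (A × M × B) ↔ (C × M × D) →
              (A × (L ⊎ M) × B) ↔ (C × (L ⊎ M) × D)
  ⊎-middle↔ {L} {M} f g = mk↔ₛ′ to from to∘from from∘to
    where
    to : A × (L ⊎ M) × B → C × (L ⊎ M) × D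
    to (a , inj₁ l , b) = relabel inj₁ (Inverse.to f (a , l , b))
    to (a , inj₂ m , b) = relabel inj₂ (Inverse.to g (a , m , b))

    from : C × (L ⊎ M) × D → A × (L ⊎ M) × B
    from (c , inj₁ l , d) = relabel inj₁ (Inverse.from f (c , l , d))
    from (c , inj₂ m , d) = relabel inj₂ (Inverse.from g (c , m , d))

    to∘from : ∀ y → to (from y) ≡ y
    to∘from (c , inj₁ l , d) = cong (relabel inj₁) (Inverse.strictlyInverseˡ f (c , l , d))
    to∘from (c , inj₂ m , d) = cong (relabel inj₂) (Inverse.strictlyInverseˡ g (c , m , d))

    from∘to : ∀ x → from (to x) ≡ x
    from∘to (a , inj₁ l , b) = cong (relabel inj₁) (Inverse.strictlyInverseʳ f (a , l , b))
    from∘to (a , inj₂ m , b) = cong (relabel inj₂) (Inverse.strictlyInverseʳ g (a , m , b))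

  ×-middle↔ : ∀ {L M : Set} → (A × L × B) ↔ (C × L × D) → (A × (L × M) × B) ↔ (C × (L × M) × D)
  ×-middle↔ {L} {M} f = mk↔ₛ′ to from to∘from from∘to
    where
    to : A × (L × M) × B → C × (L × M) × D
    to (a , (l , m) , b) = relabel (_, m) (Inverse.to f (a , l , b))

    from : C × (L × M) × D → A × (L × M) × B
    from (c , (l , m) , d) = relabel (_, m) (Inverse.from f (c , l , d))

    to∘from : ∀ y → to (from y) ≡ y
    to∘from (c , (l , m) , d) = cong (relabel (_, m)) (Inverse.strictlyInverseˡ f (c , l , d))

    from∘to : ∀ x → from (to x) ≡ x
    from∘to (a , (l , m) , b) = cong (relabel (_, m)) (Inverse.strictlyInverseʳ f (a , l , b))

Γ-coordinates : ∀ r → (Fin 4 × Fin r × Fin 4) ↔ Γ r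
Γ-coordinates r = mk↔ₛ′ to from to∘from from∘to
  where
  to : Fin 4 × Fin r × Fin 4 → Γ r
  to (q , x , b) = combine q x , b

  from : Γ r → Fin 4 × Fin r × Fin 4
  from (c , b) = let (q , x) = remQuot r c in q , x , b

  to∘from : ∀ g → to (from g) ≡ g
  to∘from (c , b) = cong (_, b) (combine-remQuot r c)

  from∘to : ∀ p → from (to p) ≡ p
  from∘to (q , x , b) = cong (λ (q , x) → q , x , b) (remQuot-combine q x)

zeroSumMRS : ∀ {r} .{{_ : NonZero (4 * r)}} {a b c} (e : (Fin c × Fin a × Fin b) ↔ Γ r) →
             (∀ k i → ΣΓ r (λ j → Inverse.to e (k , i , j)) ≡ 0Γ r) →
             (∀ k j → ΣΓ r (λ i → Inverse.to e (k , i , j)) ≡ 0Γ r) →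
             ZeroSumMRS r a b c
zeroSumMRS e rows cols = record
  { entry      = λ k i j → to (k , i , j)
  ; injective  = λ k i j k′ i′ j′ eq → ,,-injective (Injection.injective (↔⇒↣ e) eq)
  ; surjective = λ g → let (k , i , j) = from g in k , i , j , strictlyInverseˡ g
  ; rowSum     = rows
  ; colSum     = cols
  }
  where
  open Inverse e

  ,,-injective : ∀ {A B C : Set} {a a′ : A} {b b′ : B} {c c′ : C} →
                 (a , b , c) ≡ (a′ , b′ , c′) → a ≡ a′ × b ≡ b′ × c ≡ c′
  ,,-injective refl = refl , refl , refl

module Construction {c w : ℕ} (top : Block c w 3 topSign) (pair : Block c w 2 pairSign) (k : ℕ) where

  r : ℕ
  r = 3 + 2 * k

  x : Label k → Fin r
  x = Inverse.to (residueLabel↔ k)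

  cells↔ : (Fin c × Label k × Fin w) ↔ Cell (Label k)
  cells↔ = ⊎-middle↔ (Block.table↔ top) (×-middle↔ (Block.table↔ pair))

  cell : Fin c → Label k → Fin w → Cell (Label k)
  cell a l j = Inverse.to cells↔ (a , l , j)

  element : Cell (Label k) → Γ r
  element = Inverse.to (Γ-coordinates r) ∘ relabel x

  arrangement : (Fin c × Fin r × Fin w) ↔ Γ r
  arrangement = Γ-coordinates r ↔-∘ ((↔-id _ ×-↔ (residueLabel↔ k ×-↔ ↔-id _))
                ↔-∘ (cells↔ ↔-∘ (↔-id _ ×-↔ (rowLabel↔ k ×-↔ ↔-id _))))

  block-zeroSum : ∀ {ℓ n} {sign : Fin ℓ → Sign} (e : Fin ℓ → Label k) {u v} → u + v ≡ r →
                  (∀ ρ → toℕ (x (e ρ)) ≡ weight u v (sign ρ)) →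
                  (f : Fin n → Cell (Fin ℓ)) → Balanced (relabel sign ∘ f) →
                  ZeroSum r (element ∘ relabel e ∘ f)
  block-zeroSum {sign = sign} e {u} {v} u+v≡r x≡weight f balanced@(_ , _ , 4∣coords) =
    zeroSum (subst (4 * r ∣_) (sym (sum-cong-≗ (toℕ-element ∘ f)))
                   (balanced⇒∣ (relabel sign ∘ f) balanced u+v≡r))
            4∣coords
    where
    toℕ-element : ∀ p → toℕ (proj₁ (element (relabel e p))) ≡ value r u v (relabel sign p)
    toℕ-element (q , ρ , _) = begin
      toℕ (combine q (x (e ρ)))        ≡⟨ toℕ-combine q (x (e ρ)) ⟩
      r * toℕ q + toℕ (x (e ρ))        ≡⟨ cong₂ _+_ (*-comm r (toℕ q)) (x≡weight ρ) ⟩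
      toℕ q * r + weight u v (sign ρ)  ∎
      where open ≡-Reasoning

  top-zeroSum : ∀ {n} (f : Fin n → Cell (Fin 3)) → Balanced (relabel topSign ∘ f) →
                ZeroSum r (element ∘ relabel inj₁ ∘ f)
  top-zeroSum = block-zeroSum {sign = topSign} inj₁ {toℕ (x (inj₁ 1F))} {toℕ (x (inj₁ 2F))}
                              (residue-sum k zero) x≡weight
    where
    x≡weight : ∀ ρ → toℕ (x (inj₁ ρ)) ≡ weight (toℕ (x (inj₁ 1F))) (toℕ (x (inj₁ 2F))) (topSign ρ)
    x≡weight 0F = residue-zero k
    x≡weight 1F = refl
    x≡weight 2F = refl

  pair-zeroSum : ∀ m {n} (f : Fin n → Cell (Fin 2)) → Balanced (relabel pairSign ∘ f) →
                 ZeroSum r (element ∘ relabel (λ σ → inj₂ (σ , m)) ∘ f)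
  pair-zeroSum m = block-zeroSum {sign = pairSign} (λ σ → inj₂ (σ , m))
                                 {toℕ (x (inj₂ (0F , m)))} {toℕ (x (inj₂ (1F , m)))}
                                 (residue-sum k (suc m)) x≡weight
    where
    x≡weight : ∀ σ → toℕ (x (inj₂ (σ , m)))
                     ≡ weight (toℕ (x (inj₂ (0F , m)))) (toℕ (x (inj₂ (1F , m)))) (pairSign σ)
    x≡weight 0F = refl
    x≡weight 1F = refl

  rows-zeroSum : ∀ a l → ZeroSum r (λ j → element (cell a l j))
  rows-zeroSum a (inj₁ ρ) =
    top-zeroSum (λ j → Block.table top (a , ρ , j)) (Block.rows-balanced top a ρ)
  rows-zeroSum a (inj₂ (σ , m)) =
    pair-zeroSum m (λ j → Block.table pair (a , σ , j)) (Block.rows-balanced pair a σ)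

  cols-zeroSum : ∀ a j → ZeroSum r (λ i → element (cell a (rowLabel k i) j))
  cols-zeroSum a j =
    zeroSum (∣-∑-rows k (toℕ ∘ proj₁ ∘ column) (∣∑proj₁ top-part) (∣∑proj₁ ∘ pair-part))
            (∣-∑-rows k (toℕ ∘ proj₂ ∘ column) (∣∑proj₂ top-part) (∣∑proj₂ ∘ pair-part))
    where
    open ZeroSum

    column : Label k → Γ r
    column l = element (cell a l j)

    top-part : ZeroSum r (column ∘ inj₁)
    top-part = top-zeroSum (λ ρ → Block.table top (a , ρ , j)) (Block.cols-balanced top a j)

    pair-part : ∀ m → ZeroSum r (λ σ → column (inj₂ (σ , m)))
    pair-part m = pair-zeroSum m (λ σ → Block.table pair (a , σ , j)) (Block.cols-balanced pair a j)

  mrs : ZeroSumMRS r r w c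
  mrs = zeroSumMRS arrangement (λ a i → ZeroSum⇒ΣΓ≡0Γ (rows-zeroSum a (rowLabel k i)))
                               (λ a j → ZeroSum⇒ΣΓ≡0Γ (cols-zeroSum a j))

lemma4p7 : (k : ℕ) → ZeroSumMRS (3 + 2 * k) (3 + 2 * k) 8 2
lemma4p7 = Construction.mrs topBlock pairBlock
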